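{- Let $G$ be a bi-flock chicken graph (an orientation of a complete bipartite graph with flocks $V_1,V_2$). If a chicken $d$ pecks a prominent chicken $k$, then $d$ is a 3-Duke.
   Context: A bi-flock chicken graph is a finite orientation of a complete bipartite graph; its vertices are called chickens and its two partite sets are called flocks. For chickens $c,d$ we say "$c$ pecks $d$" ($c\to d$) if the edge between them is oriented from $c$ to $d$; a peck chain of length $m$ from $c$ to $c_m$ is a directed path $c\to c_1\to\cdots\to c_m$. A chicken $d$ is an $m$-Duke if for every chicken $c$ not in the flock of $d$ there is a peck chain of length at most $m$ from $d$ to $c$. A chicken is prominent if it pecks at least as many chickens as any other chicken in its own flock. -}

module Defs where

open import Data.Nat using (ℕ; zero; suc; _≤_)
open import Data.Bool using (Bool; true; false; T; not)
open import Data.Fin using (Fin)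
open import Data.Sum using (_⊎_; inj₁; inj₂)
open import Data.Vec using (count; allFin)
open import Data.Bool.Properties using (T?)
open import Data.Empty using (⊥)
open import Data.Unit using (⊤)
open import Relation.Nullary using (¬_)
open import Data.Product using (∃-syntax; _×_)

-- A bi-flock chicken graph with flocks V₁ = Fin m and V₂ = Fin n:
-- an orientation of the complete bipartite graph K_{m,n}.
-- o i j = true  means  (flock-1 chicken i) pecks (flock-2 chicken j);
-- o i j = false means  (flock-2 chicken j) pecks (flock-1 chicken i).
BiFlock : ℕ → ℕ → Set
BiFlock m n = Fin m → Fin n → Bool

Chicken : ℕ → ℕ → Set
Chicken m n = Fin m ⊎ Fin n

Pecks : ∀ {m n} → BiFlock m n → Chicken m n → Chicken m n → Set
Pecks o (inj₁ i) (inj₂ j) = T (o i j)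
Pecks o (inj₂ j) (inj₁ i) = T (not (o i j))
Pecks o (inj₁ _) (inj₁ _) = ⊥
Pecks o (inj₂ _) (inj₂ _) = ⊥

SameFlock : ∀ {m n} → Chicken m n → Chicken m n → Set
SameFlock (inj₁ _) (inj₁ _) = ⊤
SameFlock (inj₂ _) (inj₂ _) = ⊤
SameFlock _ _ = ⊥

data PeckChain {m n} (o : BiFlock m n) : ℕ → Chicken m n → Chicken m n → Set where
  here : ∀ {c} → PeckChain o zero c c
  step : ∀ {k c c₁ d} → Pecks o c c₁ → PeckChain o k c₁ d → PeckChain o (suc k) c d

outDeg : ∀ {m n} → BiFlock m n → Chicken m n → ℕ
outDeg {m} {n} o (inj₁ i) = count (λ j → T? (o i j)) (allFin n)
outDeg {m} {n} o (inj₂ j) = count (λ i → T? (not (o i j))) (allFin m)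

Prominent : ∀ {m n} → BiFlock m n → Chicken m n → Set
Prominent o c = ∀ c' → SameFlock c c' → outDeg o c' ≤ outDeg o c

Duke : ∀ {m n} → BiFlock m n → ℕ → Chicken m n → Set
Duke o ℓ d = ∀ c → ¬ SameFlock d c →
  ∃[ k ] (k ≤ ℓ × PeckChain o k d c)

-- If c is outside the flock of d and d does not peck c, then c pecks d while the
-- prominent k (pecked by d) does not.  Since c pecks no more chickens than k, some x
-- is pecked by k but not by c, i.e. x pecks c, and d → k → x → c is a peck chain.
module Submission where

open import Defs
open import Level using (Level)
open import Data.Nat using (ℕ; _≤_; _<_; z≤n; s≤s)
open import Data.Nat.Properties using (≤-refl; ≤-pred; <⇒≤; n≮0)
open import Data.Bool using (true; false; T; not)
open import Data.Bool.Properties using (T?)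
open import Data.Sum using (_⊎_; inj₁; inj₂)
open import Data.Vec using (Vec; []; _∷_; count; allFin)
open import Data.Vec.Relation.Unary.Any using (Any; here; there)
import Data.Vec.Relation.Unary.Any as Any
open import Data.Vec.Membership.Propositional.Properties using (∈-allFin⁺)
open import Data.Empty using (⊥-elim)
open import Data.Unit using (tt)
open import Data.Product using (∃-syntax; _×_; _,_)
open import Relation.Nullary using (¬_; yes; no)
open import Relation.Unary using (Pred; Decidable)
open import Relation.Binary.PropositionalEquality using (refl)

module _ {a p q : Level} {A : Set a} {P : Pred A p} {Q : Pred A q}
         (P? : Decidable P) (Q? : Decidable Q) where

  count<count⇒∃ : ∀ {n} (xs : Vec A n) → count Q? xs < count P? xs →
                  ∃[ x ] P x × ¬ Q x
  count<count⇒∃ [] q<p = ⊥-elim (n≮0 q<p)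
  count<count⇒∃ (x ∷ xs) q<p with P? x | Q? x
  ... | yes px | no ¬qx = x , px , ¬qx
  ... | yes _  | yes _  = count<count⇒∃ xs (≤-pred q<p)
  ... | no _   | yes _  = count<count⇒∃ xs (<⇒≤ q<p)
  ... | no _   | no _   = count<count⇒∃ xs q<p

  count≤count⇒∃ : ∀ {n} {xs : Vec A n} → Any (λ y → Q y × ¬ P y) xs →
                  count Q? xs ≤ count P? xs → ∃[ x ] P x × ¬ Q x
  count≤count⇒∃ {xs = x ∷ xs} (here (qx , ¬px)) q≤p with P? x | Q? x
  ... | yes px | _      = ⊥-elim (¬px px)
  ... | no _   | no ¬qx = ⊥-elim (¬qx qx)
  ... | no _   | yes _  = count<count⇒∃ xs q≤p
  count≤count⇒∃ {xs = x ∷ xs} (there any) q≤p with P? x | Q? x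
  ... | yes px | no ¬qx = x , px , ¬qx
  ... | yes _  | yes _  = count≤count⇒∃ any (≤-pred q≤p)
  ... | no _   | yes _  = count≤count⇒∃ any (<⇒≤ q≤p)
  ... | no _   | no _   = count≤count⇒∃ any q≤p

¬T⇒T-not : ∀ {b} → ¬ T b → T (not b)
¬T⇒T-not {true}  ¬t = ⊥-elim (¬t tt)
¬T⇒T-not {false} _  = tt

¬T-not⇒T : ∀ {b} → ¬ T (not b) → T b
¬T-not⇒T {true}  _  = tt
¬T-not⇒T {false} ¬t = ⊥-elim (¬t tt)

T-not⇒¬T : ∀ {b} → T (not b) → ¬ T b
T-not⇒¬T {true} () _

module _ {m n : ℕ} (o : BiFlock m n) where

  pecks-total : ∀ {c d} → ¬ SameFlock c d → Pecks o c d ⊎ Pecks o d c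
  pecks-total {inj₁ _} {inj₁ _} c≁d = ⊥-elim (c≁d tt)
  pecks-total {inj₂ _} {inj₂ _} c≁d = ⊥-elim (c≁d tt)
  pecks-total {inj₁ i} {inj₂ j} _ with o i j
  ... | true  = inj₁ tt
  ... | false = inj₂ tt
  pecks-total {inj₂ j} {inj₁ i} _ with o i j
  ... | true  = inj₂ tt
  ... | false = inj₁ tt

  pecks-asym : ∀ {c d} → Pecks o c d → ¬ Pecks o d c
  pecks-asym {inj₁ _} {inj₂ _} c→d d→c = T-not⇒¬T d→c c→d
  pecks-asym {inj₂ _} {inj₁ _} c→d d→c = T-not⇒¬T c→d d→c

  pecks⇒¬SameFlock : ∀ {c d} → Pecks o c d → ¬ SameFlock c d
  pecks⇒¬SameFlock {inj₁ _} {inj₂ _} _ ()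
  pecks⇒¬SameFlock {inj₂ _} {inj₁ _} _ ()

  outDeg≤⇒PeckChain₂ : ∀ {k c d} → SameFlock k c → Pecks o c d → ¬ Pecks o k d →
                       outDeg o c ≤ outDeg o k → PeckChain o 2 k c
  outDeg≤⇒PeckChain₂ {inj₁ a} {inj₁ b} {inj₂ y} _ c→d ¬k→d deg≤
    with count≤count⇒∃ (λ j → T? (o a j)) (λ j → T? (o b j))
           (Any.map (λ { refl → c→d , ¬k→d }) (∈-allFin⁺ y)) deg≤
  ... | x , k→x , ¬c→x = step {c₁ = inj₂ x} k→x (step (¬T⇒T-not ¬c→x) here)
  outDeg≤⇒PeckChain₂ {inj₂ a} {inj₂ b} {inj₁ y} _ c→d ¬k→d deg≤
    with count≤count⇒∃ (λ i → T? (not (o i a))) (λ i → T? (not (o i b)))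
           (Any.map (λ { refl → c→d , ¬k→d }) (∈-allFin⁺ y)) deg≤
  ... | x , k→x , ¬c→x = step {c₁ = inj₁ x} k→x (step (¬T-not⇒T ¬c→x) here)

¬SameFlock⇒SameFlock : ∀ {m n} {d k c : Chicken m n} →
                       ¬ SameFlock d k → ¬ SameFlock d c → SameFlock k c
¬SameFlock⇒SameFlock {d = inj₁ _} {inj₁ _} d≁k _ = ⊥-elim (d≁k tt)
¬SameFlock⇒SameFlock {d = inj₁ _} {inj₂ _} {inj₁ _} _ d≁c = ⊥-elim (d≁c tt)
¬SameFlock⇒SameFlock {d = inj₁ _} {inj₂ _} {inj₂ _} _ _ = tt
¬SameFlock⇒SameFlock {d = inj₂ _} {inj₂ _} d≁k _ = ⊥-elim (d≁k tt)
¬SameFlock⇒SameFlock {d = inj₂ _} {inj₁ _} {inj₂ _} _ d≁c = ⊥-elim (d≁c tt)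
¬SameFlock⇒SameFlock {d = inj₂ _} {inj₁ _} {inj₁ _} _ _ = tt

lemma1 : ∀ {m n} (o : BiFlock m n) (d k : Chicken m n) →
    Pecks o d k → Prominent o k → Duke o 3 d
lemma1 o d k d→k k-prominent c d≁c with pecks-total o d≁c
... | inj₁ d→c = 1 , s≤s z≤n , step d→c here
... | inj₂ c→d = 3 , ≤-refl , step d→k k⇝c
  where
    k∼c : SameFlock k c
    k∼c = ¬SameFlock⇒SameFlock (pecks⇒¬SameFlock o {d} {k} d→k) d≁c

    k⇝c : PeckChain o 2 k c
    k⇝c = outDeg≤⇒PeckChain₂ o k∼c c→d (pecks-asym o {d} {k} d→k) (k-prominent c k∼c)
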